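{- Let $G$ be a finite abelian group and let $S\subseteq G\setminus\{0\}$ be a symmetric subset. Let $H_1$ be an arbitrary finite graph, and let $H$ be its standard subdivision. Then \[ t(H,\mathrm{Cay}(G,S)) \;\geq\; t(K_2,\mathrm{Cay}(G,S))^{e(H)}. \]
   Context: For graphs $H$ and $F$, $\hom(H,F)$ is the number of maps $\phi:V(H)\to V(F)$ with $\phi(u)\phi(v)\in E(F)$ whenever $uv\in E(H)$, and $t(H,F)=\hom(H,F)/v(F)^{v(H)}$, where $v(\cdot)$ and $e(\cdot)$ denote the numbers of vertices and edges. For a finite abelian group $G$ (written additively) and symmetric $S\subseteq G\setminus\{0\}$ (i.e. $S=-S$), $\mathrm{Cay}(G,S)$ is the graph on vertex set $G$ in which $x,y$ are adjacent iff $y-x\in S$. The standard subdivision of a graph $H_1$ is the graph obtained by replacing each edge of $H_1$ by a path of length $2$ (i.e. inserting one new vertex on each edge). $K_2$ is the graph consisting of a single edge. -}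

module Defs where

open import Data.Bool using (Bool; true; false; _∧_)
open import Data.Nat using (ℕ; zero; suc; _+_; _*_; _^_; _<_; NonZero)
open import Data.Nat.Properties using (m^n≢0)
open import Data.Fin using (Fin; toℕ; _↑ˡ_; _↑ʳ_; zero; suc)
open import Data.List using (List; []; _∷_; [_]; map; concatMap; length; filterᵇ; allFin; zip; _++_)
open import Data.List.Relation.Unary.All using (All)
open import Data.List.Relation.Unary.Unique.Propositional using (Unique)
open import Data.Product using (_×_; _,_; proj₁; proj₂)
open import Data.Vec.Functional using (Vector) renaming (_∷_ to _◂_)
open import Data.Integer using (+_)
open import Data.Rational using (ℚ; 1ℚ) renaming (_/_ to _/ℚ_; _*_ to _*ℚ_)
open import Relation.Binary.PropositionalEquality using (_≡_)

record Graph : Set where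
  constructor graph
  field
    v     : ℕ
    edges : List (Fin v × Fin v)
open Graph public

e : Graph → ℕ
e H = length (edges H)

-- Simple graph: each edge {a,b} is listed exactly once, as (a , b) with a < b
-- (in particular there are no loops and no multiple edges).
IsSimple : Graph → Set
IsSimple H = All (λ ab → toℕ (proj₁ ab) < toℕ (proj₂ ab)) (edges H) × Unique (edges H)

K₂ : Graph
K₂ = graph 2 [ (zero , suc zero) ]

-- Standard subdivision: vertices Fin (v + k) where k = e(H₁); the first v are
-- the original vertices, vertex v+i is the new vertex on the i-th edge (a , b),
-- which is joined to a and to b.
subdivision : Graph → Graph
subdivision H₁ = graph (v H₁ + e H₁) (go (edges H₁) (allFin (e H₁)))
  where
  go : List (Fin (v H₁) × Fin (v H₁)) → List (Fin (e H₁)) →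
       List (Fin (v H₁ + e H₁) × Fin (v H₁ + e H₁))
  go ((a , b) ∷ es) (i ∷ is) =
    (a ↑ˡ e H₁ , v H₁ ↑ʳ i) ∷ (v H₁ ↑ʳ i , b ↑ˡ e H₁) ∷ go es is
  go _ _ = []

allMaps : (a n : ℕ) → List (Fin a → Fin n)
allMaps zero    n = [ (λ ()) ]
allMaps (suc a) n = concatMap (λ f → map (λ x → x ◂ f) (allFin n)) (allMaps a n)

allᵇ : {A : Set} → (A → Bool) → List A → Bool
allᵇ p []       = true
allᵇ p (x ∷ xs) = p x ∧ allᵇ p xs

hom : (H : Graph) (n : ℕ) (adj : Fin n → Fin n → Bool) → ℕ
hom H n adj =
  length (filterᵇ (λ φ → allᵇ (λ ab → adj (φ (proj₁ ab)) (φ (proj₂ ab))) (edges H))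
                  (allMaps (v H) n))

t : (H : Graph) (n : ℕ) .{{_ : NonZero n}} (adj : Fin n → Fin n → Bool) → ℚ
t H n adj = _/ℚ_ (+ hom H n adj) (n ^ v H) {{m^n≢0 n (v H)}}

_^ℚ_ : ℚ → ℕ → ℚ
q ^ℚ zero  = 1ℚ
q ^ℚ suc k = q *ℚ (q ^ℚ k)

Cay : (n : ℕ) (_+G_ : Fin n → Fin n → Fin n) (-G_ : Fin n → Fin n)
      (S : Fin n → Bool) → Fin n → Fin n → Bool
Cay n _+G_ -G_ S x y = S (y +G (-G x))

{-# OPTIONS --safe #-}
-- Write A for the indicator function of S and r(g) = ∑_w A(w) A(w + g) for its autocorrelation.
-- Since S = −S, the number of walks x → z → y in Cay(G,S) is r(x − y), so hom(H, Cay(G,S)) equals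
-- D = ∑_φ ∏_j r(φ(a_j) − φ(b_j)), summed over all φ : V(H₁) → G, where a_j b_j is the j-th edge of H₁.
-- Expanding the product, D = ∑_φ ∑_w F(w) F(w + δφ) with w ∈ G^{E(H₁)}, F(w) = ∏_j A(w_j) and
-- (δφ)_j = φ(a_j) − φ(b_j).  As δ is additive, translating w by δψ and φ by ψ shows
-- |G|^{v(H₁)} D = ∑_w N(w)² for N(w) = ∑_ψ F(w + δψ), while ∑_w N(w) = |G|^{v(H₁)} |S|^{e(H₁)}.
-- Cauchy–Schwarz over the |G|^{e(H₁)} points w gives |G|^{e(H₁)} D ≥ |G|^{v(H₁)} |S|^{2e(H₁)}, which is
-- the claimed inequality because v(H) = v(H₁) + e(H₁) and e(H) = 2 e(H₁).
module Submission where

open import Defs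
open import Algebra.Bundles using (AbelianGroup)
open import Algebra.Structures using (IsAbelianGroup)
open import Data.Bool using (Bool; true; false; _∧_)
open import Data.Fin using (Fin; zero; suc; _↑ˡ_; _↑ʳ_; splitAt)
open import Data.List as List
  using (List; []; _∷_; map; concatMap; length; filterᵇ; tabulate; allFin; lookup)
open import Data.Nat using (ℕ; zero; suc; _+_; _*_; _^_; NonZero)
open import Data.Nat.Properties
open import Data.Product using (_×_; _,_; proj₁; proj₂)
open import Data.Sum using (inj₁; inj₂)
open import Data.Vec.Functional using (Vector; head; tail; zipWith; _++_) renaming (_∷_ to _◂_)
open import Data.Vec.Functional.Properties using (∷-cong; lookup-++ˡ; lookup-++ʳ)
open import Function using (_∘_; Congruent)
open import Relation.Binary.PropositionalEquality

module Sums where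
  open import Data.Nat using (_≤_; z≤n)
  open import Algebra.Properties.CommutativeSemigroup +-commutativeSemigroup using (interchange)
  open import Data.Nat.Solver using (module +-*-Solver)
  open +-*-Solver using (solve; _:=_; _:+_; _:*_; con)

  𝟙 : Bool → ℕ
  𝟙 true  = 1
  𝟙 false = 0

  𝟙-∧ : ∀ x y → 𝟙 (x ∧ y) ≡ 𝟙 x * 𝟙 y
  𝟙-∧ true  y = sym (*-identityˡ (𝟙 y))
  𝟙-∧ false y = refl

  ∑ : {A : Set} → List A → (A → ℕ) → ℕ
  ∑ []       f = 0
  ∑ (x ∷ xs) f = f x + ∑ xs f

  infixl 10 ∑
  syntax ∑ xs (λ x → e) = ∑[ x ∈ xs ] e

  module _ {A : Set} where

    ∑-cong : ∀ xs {f g : A → ℕ} → f ≗ g → ∑ xs f ≡ ∑ xs g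
    ∑-cong []       f≗g = refl
    ∑-cong (x ∷ xs) f≗g = cong₂ _+_ (f≗g x) (∑-cong xs f≗g)

    ∑-mono-≤ : ∀ xs {f g : A → ℕ} → (∀ x → f x ≤ g x) → ∑ xs f ≤ ∑ xs g
    ∑-mono-≤ []       f≤g = z≤n
    ∑-mono-≤ (x ∷ xs) f≤g = +-mono-≤ (f≤g x) (∑-mono-≤ xs f≤g)

    ∑-distrib-+ : ∀ xs (f g : A → ℕ) → ∑[ x ∈ xs ] (f x + g x) ≡ ∑ xs f + ∑ xs g
    ∑-distrib-+ []       f g = refl
    ∑-distrib-+ (x ∷ xs) f g =
      trans (cong (f x + g x +_) (∑-distrib-+ xs f g)) (interchange (f x) (g x) _ _)

    *-distribˡ-∑ : ∀ c xs (f : A → ℕ) → c * ∑ xs f ≡ ∑[ x ∈ xs ] (c * f x)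
    *-distribˡ-∑ c []       f = *-zeroʳ c
    *-distribˡ-∑ c (x ∷ xs) f =
      trans (*-distribˡ-+ c (f x) (∑ xs f)) (cong (c * f x +_) (*-distribˡ-∑ c xs f))

    *-distribʳ-∑ : ∀ c xs (f : A → ℕ) → ∑ xs f * c ≡ ∑[ x ∈ xs ] (f x * c)
    *-distribʳ-∑ c xs f =
      trans (*-comm (∑ xs f) c) (trans (*-distribˡ-∑ c xs f) (∑-cong xs (λ x → *-comm c (f x))))

    ∑-const : ∀ (xs : List A) c → ∑[ _ ∈ xs ] c ≡ length xs * c
    ∑-const []       c = refl
    ∑-const (x ∷ xs) c = cong (c +_) (∑-const xs c)

    ∑-++ : ∀ xs ys (f : A → ℕ) → ∑ (xs List.++ ys) f ≡ ∑ xs f + ∑ ys f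
    ∑-++ []       ys f = refl
    ∑-++ (x ∷ xs) ys f = trans (cong (f x +_) (∑-++ xs ys f)) (sym (+-assoc (f x) _ _))

    length-filterᵇ : ∀ p (xs : List A) → length (filterᵇ p xs) ≡ ∑[ x ∈ xs ] 𝟙 (p x)
    length-filterᵇ p [] = refl
    length-filterᵇ p (x ∷ xs) with p x
    ... | true  = cong suc (length-filterᵇ p xs)
    ... | false = length-filterᵇ p xs

  module _ {A B : Set} where

    ∑-map : ∀ (g : B → A) xs (f : A → ℕ) → ∑ (map g xs) f ≡ ∑[ y ∈ xs ] f (g y)
    ∑-map g []       f = refl
    ∑-map g (y ∷ ys) f = cong (f (g y) +_) (∑-map g ys f)

    ∑-concatMap : ∀ (g : B → List A) xs (f : A → ℕ) →
                  ∑ (concatMap g xs) f ≡ ∑[ y ∈ xs ] ∑ (g y) f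
    ∑-concatMap g []       f = refl
    ∑-concatMap g (y ∷ ys) f =
      trans (∑-++ (g y) (concatMap g ys) f) (cong (∑ (g y) f +_) (∑-concatMap g ys f))

    ∑-comm : ∀ xs ys (f : A → B → ℕ) →
             ∑[ x ∈ xs ] ∑[ y ∈ ys ] f x y ≡ ∑[ y ∈ ys ] ∑[ x ∈ xs ] f x y
    ∑-comm []       ys f = sym (trans (∑-const ys 0) (*-zeroʳ (length ys)))
    ∑-comm (x ∷ xs) ys f = begin
      ∑ ys (f x) + ∑[ x′ ∈ xs ] ∑ ys (f x′)         ≡⟨ cong (∑ ys (f x) +_) (∑-comm xs ys f) ⟩
      ∑ ys (f x) + ∑[ y ∈ ys ] ∑[ x′ ∈ xs ] f x′ y  ≡⟨ ∑-distrib-+ ys (f x) _ ⟨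
      ∑[ y ∈ ys ] (f x y + ∑[ x′ ∈ xs ] f x′ y)     ∎
      where open ≡-Reasoning

    ∑-*-∑ : ∀ xs ys (f : A → ℕ) (g : B → ℕ) →
            ∑ xs f * ∑ ys g ≡ ∑[ x ∈ xs ] ∑[ y ∈ ys ] (f x * g y)
    ∑-*-∑ xs ys f g =
      trans (*-distribʳ-∑ (∑ ys g) xs f) (∑-cong xs (λ x → *-distribˡ-∑ (f x) ys g))

  ∑-∑-+ : ∀ {A : Set} (xs : List A) (g : A → ℕ) →
          ∑[ x ∈ xs ] ∑[ y ∈ xs ] (g x + g y) ≡ 2 * (length xs * ∑ xs g)
  ∑-∑-+ xs g = begin
    ∑[ x ∈ xs ] ∑[ y ∈ xs ] (g x + g y)
      ≡⟨ ∑-cong xs (λ x → ∑-distrib-+ xs (λ _ → g x) g) ⟩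
    ∑[ x ∈ xs ] (∑[ _ ∈ xs ] g x + ∑ xs g)
      ≡⟨ ∑-distrib-+ xs _ _ ⟩
    ∑[ x ∈ xs ] ∑[ _ ∈ xs ] g x + ∑[ _ ∈ xs ] ∑ xs g
      ≡⟨ cong₂ _+_ (∑-cong xs (λ x → ∑-const xs (g x))) (∑-const xs _) ⟩
    ∑[ x ∈ xs ] (length xs * g x) + length xs * ∑ xs g
      ≡⟨ cong (_+ length xs * ∑ xs g) (*-distribˡ-∑ (length xs) xs g) ⟨
    length xs * ∑ xs g + length xs * ∑ xs g
      ≡⟨ cong (length xs * ∑ xs g +_) (+-identityʳ _) ⟨
    2 * (length xs * ∑ xs g)
      ∎
    where open ≡-Reasoning

  private
    2*m*n≤m*m+n*n-ordered : ∀ {m n} → m ≤ n → 2 * (m * n) ≤ m * m + n * n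
    2*m*n≤m*m+n*n-ordered {m} m≤n with m≤n⇒∃[o]m+o≡n m≤n
    ... | d , refl = subst (2 * (m * (m + d)) ≤_) (sym (square-gap m d)) (m≤m+n _ (d * d))
      where
      square-gap : ∀ m d → m * m + (m + d) * (m + d) ≡ 2 * (m * (m + d)) + d * d
      square-gap = solve 2 (λ m d → m :* m :+ (m :+ d) :* (m :+ d) := con 2 :* (m :* (m :+ d)) :+ d :* d)
                           refl

  2*m*n≤m*m+n*n : ∀ m n → 2 * (m * n) ≤ m * m + n * n
  2*m*n≤m*m+n*n m n with ≤-total m n
  ... | inj₁ m≤n = 2*m*n≤m*m+n*n-ordered m≤n
  ... | inj₂ n≤m =
    subst₂ _≤_ (cong (2 *_) (*-comm n m)) (+-comm (n * n) (m * m)) (2*m*n≤m*m+n*n-ordered n≤m)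

  cauchy-schwarz : ∀ {A : Set} (xs : List A) (f : A → ℕ) →
                   ∑ xs f * ∑ xs f ≤ length xs * ∑[ x ∈ xs ] (f x * f x)
  cauchy-schwarz xs f = *-cancelˡ-≤ 2 (begin
    2 * (∑ xs f * ∑ xs f)
      ≡⟨ cong (2 *_) (∑-*-∑ xs xs f f) ⟩
    2 * ∑[ x ∈ xs ] ∑[ y ∈ xs ] (f x * f y)
      ≡⟨ trans (*-distribˡ-∑ 2 xs _) (∑-cong xs (λ x → *-distribˡ-∑ 2 xs _)) ⟩
    ∑[ x ∈ xs ] ∑[ y ∈ xs ] (2 * (f x * f y))
      ≤⟨ ∑-mono-≤ xs (λ x → ∑-mono-≤ xs (λ y → 2*m*n≤m*m+n*n (f x) (f y))) ⟩
    ∑[ x ∈ xs ] ∑[ y ∈ xs ] (f x * f x + f y * f y)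
      ≡⟨ ∑-∑-+ xs (λ x → f x * f x) ⟩
    2 * (length xs * ∑[ x ∈ xs ] (f x * f x))
      ∎)
    where open ≤-Reasoning

module MapSums where
  open Sums
  open import Data.Fin.Permutation using (Permutation′; _⟨$⟩ʳ_)
  open import Data.List.Properties using (length-tabulate)
  open import Data.Sum.Properties using ([,]-map)
  import Algebra.Properties.CommutativeMonoid.Sum as MonoidSum
  private
    module +-Sum = MonoidSum +-0-commutativeMonoid
  open MonoidSum *-1-commutativeMonoid public
    using () renaming (sum to ∏; sum-cong-≗ to ∏-cong; ∑-distrib-+ to ∏-distrib-*)

  ∏-const : ∀ k c → ∏ {k} (λ _ → c) ≡ c ^ k
  ∏-const zero    c = refl
  ∏-const (suc k) c = cong (c *_) (∏-const k c)

  ∷-++ : ∀ {A : Set} {m k} (x : A) (xs : Vector A m) (ys : Vector A k) →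
         x ◂ (xs ++ ys) ≗ (x ◂ xs) ++ ys
  ∷-++ {m = m} x xs ys = ∷-cong refl (λ i → sym ([,]-map (splitAt m i)))

  ∑-tabulate : ∀ {A : Set} {k} (g : Fin k → A) (f : A → ℕ) →
               ∑ (tabulate g) f ≡ +-Sum.sum (f ∘ g)
  ∑-tabulate {k = zero}  g f = refl
  ∑-tabulate {k = suc k} g f = cong (f (g zero) +_) (∑-tabulate (g ∘ suc) f)

  module _ {n : ℕ} where

    ∑-allFin-permute : ∀ (π : Permutation′ n) (f : Fin n → ℕ) →
                       ∑[ x ∈ allFin n ] f (π ⟨$⟩ʳ x) ≡ ∑ (allFin n) f
    ∑-allFin-permute π f = begin
      ∑[ x ∈ allFin n ] f (π ⟨$⟩ʳ x)  ≡⟨ ∑-tabulate (λ x → x) (f ∘ (π ⟨$⟩ʳ_)) ⟩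
      +-Sum.sum (f ∘ (π ⟨$⟩ʳ_))       ≡⟨ +-Sum.sum-permute f π ⟨
      +-Sum.sum f                     ≡⟨ ∑-tabulate (λ x → x) f ⟨
      ∑ (allFin n) f                  ∎
      where open ≡-Reasoning

    ∑-allFin-const : ∀ c → ∑[ _ ∈ allFin n ] c ≡ n * c
    ∑-allFin-const c =
      trans (∑-const (allFin n) c) (cong (_* c) (length-tabulate {n = n} (λ x → x)))

    ∑-allMaps-suc : ∀ k (g : Vector (Fin n) (suc k) → ℕ) →
                    ∑ (allMaps (suc k) n) g ≡ ∑[ f ∈ allMaps k n ] ∑[ x ∈ allFin n ] g (x ◂ f)
    ∑-allMaps-suc k g = trans (∑-concatMap _ (allMaps k n) g)
                              (∑-cong (allMaps k n) (λ f → ∑-map (_◂ f) (allFin n) g))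

    ∑-allMaps-const : ∀ k c → ∑[ _ ∈ allMaps k n ] c ≡ n ^ k * c
    ∑-allMaps-const zero    c = refl
    ∑-allMaps-const (suc k) c = begin
      ∑[ _ ∈ allMaps (suc k) n ] c              ≡⟨ ∑-allMaps-suc k _ ⟩
      ∑[ _ ∈ allMaps k n ] ∑[ _ ∈ allFin n ] c  ≡⟨ ∑-cong (allMaps k n) (λ _ → ∑-allFin-const c) ⟩
      ∑[ _ ∈ allMaps k n ] (n * c)              ≡⟨ ∑-allMaps-const k (n * c) ⟩
      n ^ k * (n * c)                           ≡⟨ *-assoc (n ^ k) n c ⟨
      n ^ k * n * c                             ≡⟨ cong (_* c) (*-comm (n ^ k) n) ⟩
      n * n ^ k * c                             ∎
      where open ≡-Reasoning

    length-allMaps : ∀ k → length (allMaps k n) ≡ n ^ k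
    length-allMaps k = begin
      length (allMaps k n)       ≡⟨ *-identityʳ _ ⟨
      length (allMaps k n) * 1   ≡⟨ ∑-const (allMaps k n) 1 ⟨
      ∑[ _ ∈ allMaps k n ] 1     ≡⟨ ∑-allMaps-const k 1 ⟩
      n ^ k * 1                  ≡⟨ *-identityʳ _ ⟩
      n ^ k                      ∎
      where open ≡-Reasoning

    ∑-allMaps-∏ : ∀ k (F : Fin k → Fin n → ℕ) →
                  ∑[ ψ ∈ allMaps k n ] ∏ (λ j → F j (ψ j)) ≡ ∏ (λ j → ∑ (allFin n) (F j))
    ∑-allMaps-∏ zero    F = refl
    ∑-allMaps-∏ (suc k) F = begin
      ∑[ ψ ∈ allMaps (suc k) n ] ∏ (λ j → F j (ψ j))
        ≡⟨ ∑-allMaps-suc k _ ⟩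
      ∑[ f ∈ allMaps k n ] ∑[ x ∈ allFin n ] (F zero x * ∏ (λ j → F (suc j) (f j)))
        ≡⟨ ∑-cong (allMaps k n) (λ f → *-distribʳ-∑ _ (allFin n) (F zero)) ⟨
      ∑[ f ∈ allMaps k n ] (∑ (allFin n) (F zero) * ∏ (λ j → F (suc j) (f j)))
        ≡⟨ *-distribˡ-∑ (∑ (allFin n) (F zero)) (allMaps k n) _ ⟨
      ∑ (allFin n) (F zero) * ∑[ f ∈ allMaps k n ] ∏ (λ j → F (suc j) (f j))
        ≡⟨ cong (∑ (allFin n) (F zero) *_) (∑-allMaps-∏ k (F ∘ suc)) ⟩
      ∑ (allFin n) (F zero) * ∏ (λ j → ∑ (allFin n) (F (suc j)))
        ∎
      where open ≡-Reasoning

    -- Maps assembled in different ways (by _◂_, _++_, zipWith) agree only pointwise, so without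
    -- function extensionality the summand has to be assumed to respect pointwise equality.
    ∑-allMaps-++ : ∀ V E (g : Vector (Fin n) (V + E) → ℕ) → Congruent _≗_ _≡_ g →
                   ∑ (allMaps (V + E) n) g ≡ ∑[ φ ∈ allMaps V n ] ∑[ ψ ∈ allMaps E n ] g (φ ++ ψ)
    ∑-allMaps-++ zero    E g g-cong =
      trans (∑-cong (allMaps E n) (λ ψ → g-cong (λ _ → refl)))
            (sym (+-identityʳ (∑[ ψ ∈ allMaps E n ] g ψ)))
    ∑-allMaps-++ (suc V) E g g-cong = begin
      ∑ (allMaps (suc V + E) n) g
        ≡⟨ ∑-allMaps-suc (V + E) g ⟩
      ∑[ Φ ∈ allMaps (V + E) n ] ∑[ x ∈ allFin n ] g (x ◂ Φ)
        ≡⟨ ∑-allMaps-++ V E _ (λ Φ≗Φ′ → ∑-cong (allFin n) (λ x → g-cong (∷-cong refl Φ≗Φ′))) ⟩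
      ∑[ φ ∈ allMaps V n ] ∑[ ψ ∈ allMaps E n ] ∑[ x ∈ allFin n ] g (x ◂ (φ ++ ψ))
        ≡⟨ ∑-cong (allMaps V n) (λ φ → ∑-comm (allMaps E n) (allFin n) _) ⟩
      ∑[ φ ∈ allMaps V n ] ∑[ x ∈ allFin n ] ∑[ ψ ∈ allMaps E n ] g (x ◂ (φ ++ ψ))
        ≡⟨ ∑-cong (allMaps V n) (λ φ → ∑-cong (allFin n) (λ x →
             ∑-cong (allMaps E n) (λ ψ → g-cong (∷-++ x φ ψ)))) ⟩
      ∑[ φ ∈ allMaps V n ] ∑[ x ∈ allFin n ] ∑[ ψ ∈ allMaps E n ] g ((x ◂ φ) ++ ψ)
        ≡⟨ ∑-allMaps-suc V _ ⟨
      ∑[ φ ∈ allMaps (suc V) n ] ∑[ ψ ∈ allMaps E n ] g (φ ++ ψ)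
        ∎
      where open ≡-Reasoning

module Autocorrelation {n : ℕ} {op : Fin n → Fin n → Fin n} {ε : Fin n} {inv : Fin n → Fin n}
                       (isAbelianGroup : IsAbelianGroup _≡_ op ε inv) where
  open Sums
  open MapSums
  open import Data.Nat using (_≤_)
  open import Data.Fin.Permutation using (permutation)
  open import Data.Fin.Properties using (nonZeroIndex)

  private
    abelianGroup : AbelianGroup _ _
    abelianGroup = record { isAbelianGroup = isAbelianGroup }
  open AbelianGroup abelianGroup public using (_∙_; _⁻¹)
  open AbelianGroup abelianGroup using (assoc)
  open import Algebra.Properties.AbelianGroup abelianGroup
    using (⁻¹-∙-comm; //-rightDividesˡ; //-rightDividesʳ; ⁻¹-anti-homo-//)
  open import Algebra.Properties.CommutativeSemigroup (AbelianGroup.commutativeSemigroup abelianGroup)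
    using (interchange; xy∙z≈x∙zy)
  open import Algebra.Properties.CommutativeSemigroup *-commutativeSemigroup
    using () renaming (interchange to *-interchange; x∙yz≈y∙xz to *-exchange)

  ∑-allFin-translate : ∀ c (f : Fin n → ℕ) → ∑[ x ∈ allFin n ] f (x ∙ c) ≡ ∑ (allFin n) f
  ∑-allFin-translate c =
    ∑-allFin-permute (permutation (_∙ c) (_∙ c ⁻¹) (//-rightDividesˡ c) (//-rightDividesʳ c))

  infixl 6 _⊕_
  _⊕_ : ∀ {k} → Vector (Fin n) k → Vector (Fin n) k → Vector (Fin n) k
  _⊕_ = zipWith _∙_

  ∑-allMaps-translate : ∀ k (t : Vector (Fin n) k) (g : Vector (Fin n) k → ℕ) →
                        Congruent _≗_ _≡_ g → ∑[ f ∈ allMaps k n ] g (f ⊕ t) ≡ ∑ (allMaps k n) g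
  ∑-allMaps-translate zero    t g g-cong = cong (_+ 0) (g-cong (λ ()))
  ∑-allMaps-translate (suc k) t g g-cong = begin
    ∑[ f ∈ allMaps (suc k) n ] g (f ⊕ t)
      ≡⟨ ∑-allMaps-suc k _ ⟩
    ∑[ f ∈ allMaps k n ] ∑[ x ∈ allFin n ] g ((x ◂ f) ⊕ t)
      ≡⟨ ∑-cong (allMaps k n) (λ f → ∑-cong (allFin n) (λ x → g-cong (∷-cong refl λ _ → refl))) ⟩
    ∑[ f ∈ allMaps k n ] ∑[ x ∈ allFin n ] g ((x ∙ head t) ◂ (f ⊕ tail t))
      ≡⟨ ∑-cong (allMaps k n) (λ f → ∑-allFin-translate (head t) (λ y → g (y ◂ (f ⊕ tail t)))) ⟩
    ∑[ f ∈ allMaps k n ] ∑[ x ∈ allFin n ] g (x ◂ (f ⊕ tail t))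
      ≡⟨ ∑-allMaps-translate k (tail t) _ (λ f≗f′ →
           ∑-cong (allFin n) (λ x → g-cong (∷-cong refl f≗f′))) ⟩
    ∑[ f ∈ allMaps k n ] ∑[ x ∈ allFin n ] g (x ◂ f)
      ≡⟨ ∑-allMaps-suc k g ⟨
    ∑ (allMaps (suc k) n) g
      ∎
    where open ≡-Reasoning

  module _ (A : Fin n → ℕ) where

    autocorrelation : Fin n → ℕ
    autocorrelation g = ∑[ w ∈ allFin n ] (A w * A (w ∙ g))

    ∑-∑-difference : ∑[ y ∈ allFin n ] ∑[ x ∈ allFin n ] A (y ∙ x ⁻¹) ≡ n * ∑ (allFin n) A
    ∑-∑-difference = begin
      ∑[ y ∈ allFin n ] ∑[ x ∈ allFin n ] A (y ∙ x ⁻¹)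
        ≡⟨ ∑-comm (allFin n) (allFin n) _ ⟩
      ∑[ x ∈ allFin n ] ∑[ y ∈ allFin n ] A (y ∙ x ⁻¹)
        ≡⟨ ∑-cong (allFin n) (λ x → ∑-allFin-translate (x ⁻¹) A) ⟩
      ∑[ _ ∈ allFin n ] ∑ (allFin n) A
        ≡⟨ ∑-allFin-const {n} _ ⟩
      n * ∑ (allFin n) A
        ∎
      where open ≡-Reasoning

    convolution≡autocorrelation : (∀ x → A (x ⁻¹) ≡ A x) → ∀ x y →
      ∑[ z ∈ allFin n ] (A (z ∙ x ⁻¹) * A (y ∙ z ⁻¹)) ≡ autocorrelation (x ∙ y ⁻¹)
    convolution≡autocorrelation A-sym x y = begin
      ∑[ z ∈ allFin n ] (A (z ∙ x ⁻¹) * A (y ∙ z ⁻¹))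
        ≡⟨ ∑-allFin-translate x _ ⟨
      ∑[ w ∈ allFin n ] (A (w ∙ x ∙ x ⁻¹) * A (y ∙ (w ∙ x) ⁻¹))
        ≡⟨ ∑-cong (allFin n) (λ w → cong₂ _*_ (cong A (//-rightDividesʳ x w)) (reflect w)) ⟩
      ∑[ w ∈ allFin n ] (A w * A (w ∙ (x ∙ y ⁻¹)))
        ∎
      where
      open ≡-Reasoning
      reflect : ∀ w → A (y ∙ (w ∙ x) ⁻¹) ≡ A (w ∙ (x ∙ y ⁻¹))
      reflect w = begin
        A (y ∙ (w ∙ x) ⁻¹)      ≡⟨ A-sym _ ⟨
        A ((y ∙ (w ∙ x) ⁻¹) ⁻¹)  ≡⟨ cong A (⁻¹-anti-homo-// y (w ∙ x)) ⟩
        A (w ∙ x ∙ y ⁻¹)         ≡⟨ cong A (assoc w x (y ⁻¹)) ⟩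
        A (w ∙ (x ∙ y ⁻¹))       ∎

    module _ {V E : ℕ} (a b : Fin E → Fin V) where
      private
        instance
          n-nonZero : NonZero n
          n-nonZero = nonZeroIndex ε

        δ : Vector (Fin n) V → Vector (Fin n) E
        δ φ j = φ (a j) ∙ φ (b j) ⁻¹

        δ-cong : ∀ {φ φ′} → φ ≗ φ′ → δ φ ≗ δ φ′
        δ-cong φ≗φ′ j = cong₂ (λ p q → p ∙ q ⁻¹) (φ≗φ′ (a j)) (φ≗φ′ (b j))

        δ-⊕ : ∀ φ ψ → δ (φ ⊕ ψ) ≗ δ φ ⊕ δ ψ
        δ-⊕ φ ψ j = trans (cong (φ (a j) ∙ ψ (a j) ∙_) (sym (⁻¹-∙-comm (φ (b j)) (ψ (b j)))))
                          (interchange (φ (a j)) (ψ (a j)) (φ (b j) ⁻¹) (ψ (b j) ⁻¹))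

        weight : Vector (Fin n) E → ℕ
        weight w = ∏ (λ j → A (w j))

        weight-cong : Congruent _≗_ _≡_ weight
        weight-cong w≗w′ = ∏-cong (λ j → cong A (w≗w′ j))

        D : ℕ
        D = ∑[ φ ∈ allMaps V n ] ∏ (λ j → autocorrelation (δ φ j))

        X : Vector (Fin n) V → Vector (Fin n) E → ℕ
        X ψ u = weight (u ⊕ δ ψ)

        N : Vector (Fin n) E → ℕ
        N u = ∑[ ψ ∈ allMaps V n ] X ψ u

        ∏-autocorrelation : ∀ φ → ∏ (λ j → autocorrelation (δ φ j)) ≡
                                  ∑[ w ∈ allMaps E n ] (weight w * weight (w ⊕ δ φ))
        ∏-autocorrelation φ = begin
          ∏ (λ j → autocorrelation (δ φ j))
            ≡⟨ ∑-allMaps-∏ E (λ j w → A w * A (w ∙ δ φ j)) ⟨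
          ∑[ w ∈ allMaps E n ] ∏ (λ j → A (w j) * A (w j ∙ δ φ j))
            ≡⟨ ∑-cong (allMaps E n) (λ w → ∏-distrib-* (A ∘ w) (λ j → A (w j ∙ δ φ j))) ⟩
          ∑[ w ∈ allMaps E n ] (weight w * weight (w ⊕ δ φ))
            ∎
          where open ≡-Reasoning

        D-translate : ∀ ψ → D ≡ ∑[ χ ∈ allMaps V n ] ∑[ u ∈ allMaps E n ] (X ψ u * X χ u)
        D-translate ψ = begin
          D
            ≡⟨ ∑-cong (allMaps V n) ∏-autocorrelation ⟩
          ∑[ φ ∈ allMaps V n ] ∑[ w ∈ allMaps E n ] (weight w * weight (w ⊕ δ φ))
            ≡⟨ ∑-cong (allMaps V n) (λ φ → ∑-allMaps-translate E (δ ψ) _ (λ w≗w′ →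
                 cong₂ _*_ (weight-cong w≗w′) (weight-cong (λ j → cong (_∙ δ φ j) (w≗w′ j))))) ⟨
          ∑[ φ ∈ allMaps V n ] ∑[ u ∈ allMaps E n ] (X ψ u * weight (u ⊕ δ ψ ⊕ δ φ))
            ≡⟨ ∑-cong (allMaps V n) (λ φ → ∑-cong (allMaps E n) (λ u →
                 cong (X ψ u *_) (weight-cong (λ j →
                   trans (xy∙z≈x∙zy (u j) _ _) (cong (u j ∙_) (sym (δ-⊕ φ ψ j))))))) ⟩
          ∑[ φ ∈ allMaps V n ] ∑[ u ∈ allMaps E n ] (X ψ u * X (φ ⊕ ψ) u)
            ≡⟨ ∑-allMaps-translate V ψ _ (λ φ≗φ′ → ∑-cong (allMaps E n) (λ u →
                 cong (X ψ u *_) (weight-cong (λ j → cong (u j ∙_) (δ-cong φ≗φ′ j))))) ⟩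
          ∑[ χ ∈ allMaps V n ] ∑[ u ∈ allMaps E n ] (X ψ u * X χ u)
            ∎
          where open ≡-Reasoning

        D-as-∑-squares : n ^ V * D ≡ ∑[ u ∈ allMaps E n ] (N u * N u)
        D-as-∑-squares = begin
          n ^ V * D
            ≡⟨ ∑-allMaps-const V D ⟨
          ∑[ _ ∈ allMaps V n ] D
            ≡⟨ ∑-cong (allMaps V n) D-translate ⟩
          ∑[ ψ ∈ allMaps V n ] ∑[ χ ∈ allMaps V n ] ∑[ u ∈ allMaps E n ] (X ψ u * X χ u)
            ≡⟨ ∑-cong (allMaps V n) (λ ψ → ∑-comm (allMaps V n) (allMaps E n) _) ⟩
          ∑[ ψ ∈ allMaps V n ] ∑[ u ∈ allMaps E n ] ∑[ χ ∈ allMaps V n ] (X ψ u * X χ u)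
            ≡⟨ ∑-comm (allMaps V n) (allMaps E n) _ ⟩
          ∑[ u ∈ allMaps E n ] ∑[ ψ ∈ allMaps V n ] ∑[ χ ∈ allMaps V n ] (X ψ u * X χ u)
            ≡⟨ ∑-cong (allMaps E n) (λ u →
                 sym (∑-*-∑ (allMaps V n) (allMaps V n) (λ ψ → X ψ u) (λ χ → X χ u))) ⟩
          ∑[ u ∈ allMaps E n ] (N u * N u)
            ∎
          where open ≡-Reasoning

        ∑-N : ∑ (allMaps E n) N ≡ n ^ V * ∑ (allFin n) A ^ E
        ∑-N = begin
          ∑[ u ∈ allMaps E n ] ∑[ ψ ∈ allMaps V n ] weight (u ⊕ δ ψ)
            ≡⟨ ∑-comm (allMaps E n) (allMaps V n) _ ⟩
          ∑[ ψ ∈ allMaps V n ] ∑[ u ∈ allMaps E n ] weight (u ⊕ δ ψ)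
            ≡⟨ ∑-cong (allMaps V n) (λ ψ → ∑-allMaps-translate E (δ ψ) weight weight-cong) ⟩
          ∑[ _ ∈ allMaps V n ] ∑ (allMaps E n) weight
            ≡⟨ ∑-allMaps-const V _ ⟩
          n ^ V * ∑ (allMaps E n) weight
            ≡⟨ cong (n ^ V *_) (trans (∑-allMaps-∏ E (λ _ → A)) (∏-const E _)) ⟩
          n ^ V * ∑ (allFin n) A ^ E
            ∎
          where open ≡-Reasoning

      ∑∏-autocorrelation-≥ :
        n ^ V * (∑ (allFin n) A ^ E * ∑ (allFin n) A ^ E) ≤
        n ^ E * ∑[ φ ∈ allMaps V n ] ∏ (λ j → autocorrelation (φ (a j) ∙ φ (b j) ⁻¹))
      ∑∏-autocorrelation-≥ = *-cancelˡ-≤ (n ^ V) {{m^n≢0 n V}} (begin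
        n ^ V * (n ^ V * (s ^ E * s ^ E))
          ≡⟨ trans (*-interchange (n ^ V) (s ^ E) (n ^ V) (s ^ E)) (*-assoc (n ^ V) (n ^ V) _) ⟨
        n ^ V * s ^ E * (n ^ V * s ^ E)
          ≡⟨ cong₂ _*_ ∑-N ∑-N ⟨
        ∑ (allMaps E n) N * ∑ (allMaps E n) N
          ≤⟨ cauchy-schwarz (allMaps E n) N ⟩
        length (allMaps E n) * ∑[ u ∈ allMaps E n ] (N u * N u)
          ≡⟨ cong₂ _*_ (length-allMaps E) (sym D-as-∑-squares) ⟩
        n ^ E * (n ^ V * D)
          ≡⟨ *-exchange (n ^ E) (n ^ V) D ⟩
        n ^ V * (n ^ E * D)
          ∎)
        where
        open ≤-Reasoning
        s = ∑ (allFin n) A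

module Homomorphisms where
  open Sums
  open MapSums
  open import Data.Bool.Properties using (∧-identityʳ)

  preserves : ∀ {m n} → (Fin n → Fin n → Bool) → Vector (Fin n) m → Fin m × Fin m → Bool
  preserves adj φ (a , b) = adj (φ a) (φ b)

  hom-as-∑ : ∀ H n adj →
             hom H n adj ≡ ∑[ φ ∈ allMaps (v H) n ] 𝟙 (allᵇ (preserves adj φ) (edges H))
  hom-as-∑ H n adj = length-filterᵇ _ (allMaps (v H) n)

  hom-K₂ : ∀ n adj → hom K₂ n adj ≡ ∑[ y ∈ allFin n ] ∑[ x ∈ allFin n ] 𝟙 (adj x y)
  hom-K₂ n adj = begin
    hom K₂ n adj
      ≡⟨ hom-as-∑ K₂ n adj ⟩
    ∑[ φ ∈ allMaps 2 n ] 𝟙 (adj (φ zero) (φ (suc zero)) ∧ true)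
      ≡⟨ ∑-allMaps-suc {n} 1 _ ⟩
    ∑[ f ∈ allMaps 1 n ] ∑[ x ∈ allFin n ] 𝟙 (adj x (f zero) ∧ true)
      ≡⟨ ∑-allMaps-suc {n} 0 _ ⟩
    ∑[ y ∈ allFin n ] ∑[ x ∈ allFin n ] 𝟙 (adj x y ∧ true) + 0
      ≡⟨ +-identityʳ _ ⟩
    ∑[ y ∈ allFin n ] ∑[ x ∈ allFin n ] 𝟙 (adj x y ∧ true)
      ≡⟨ ∑-cong (allFin n) (λ y → ∑-cong (allFin n) (λ x → cong 𝟙 (∧-identityʳ (adj x y)))) ⟩
    ∑[ y ∈ allFin n ] ∑[ x ∈ allFin n ] 𝟙 (adj x y)
      ∎
    where open ≡-Reasoning

  module _ {n : ℕ} (adj : Fin n → Fin n → Bool) where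

    walk₂ : Fin n → Fin n → Fin n → ℕ
    walk₂ x z y = 𝟙 (adj x z) * 𝟙 (adj z y)

    walks₂ : Fin n → Fin n → ℕ
    walks₂ x y = ∑[ z ∈ allFin n ] walk₂ x z y

    walk₂-cong : ∀ {x x′ z z′ y y′} → x ≡ x′ → z ≡ z′ → y ≡ y′ → walk₂ x z y ≡ walk₂ x′ z′ y′
    walk₂-cong refl refl refl = refl

  module _ {V E : ℕ} where

    subdivisionEdges : List (Fin V × Fin V) → List (Fin E) → List (Fin (V + E) × Fin (V + E))
    subdivisionEdges ((a , b) ∷ es) (i ∷ is) =
      (a ↑ˡ E , V ↑ʳ i) ∷ (V ↑ʳ i , b ↑ˡ E) ∷ subdivisionEdges es is
    subdivisionEdges _ _ = []

    subdivisionEdges-unique :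
      (go : List (Fin V × Fin V) → List (Fin E) → List (Fin (V + E) × Fin (V + E))) →
      (∀ a b es i is →
         go ((a , b) ∷ es) (i ∷ is) ≡ (a ↑ˡ E , V ↑ʳ i) ∷ (V ↑ʳ i , b ↑ˡ E) ∷ go es is) →
      (∀ is → go [] is ≡ []) → (∀ ab es → go (ab ∷ es) [] ≡ []) →
      ∀ es is → go es is ≡ subdivisionEdges es is
    subdivisionEdges-unique go step nilˡ nilʳ []             is       = nilˡ is
    subdivisionEdges-unique go step nilˡ nilʳ (ab ∷ es)      []       = nilʳ ab es
    subdivisionEdges-unique go step nilˡ nilʳ ((a , b) ∷ es) (i ∷ is) =
      trans (step a b es i is)
            (cong (λ l → _ ∷ _ ∷ l) (subdivisionEdges-unique go step nilˡ nilʳ es is))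

    length-subdivisionEdges : ∀ es (f : Fin (length es) → Fin E) →
                              length (subdivisionEdges es (tabulate f)) ≡ length es + length es
    length-subdivisionEdges []             f = refl
    length-subdivisionEdges ((a , b) ∷ es) f =
      cong suc (trans (cong suc (length-subdivisionEdges es (f ∘ suc)))
                      (sym (+-suc (length es) (length es))))

    allᵇ-subdivisionEdges : ∀ {n} adj (Φ : Vector (Fin n) (V + E)) es (f : Fin (length es) → Fin E) →
      𝟙 (allᵇ (preserves adj Φ) (subdivisionEdges es (tabulate f))) ≡
      ∏ (λ j → walk₂ adj (Φ (proj₁ (lookup es j) ↑ˡ E)) (Φ (V ↑ʳ f j)) (Φ (proj₂ (lookup es j) ↑ˡ E)))
    allᵇ-subdivisionEdges adj Φ []             f = refl
    allᵇ-subdivisionEdges adj Φ ((a , b) ∷ es) f = begin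
      𝟙 (p ∧ (q ∧ rest))   ≡⟨ 𝟙-∧ p (q ∧ rest) ⟩
      𝟙 p * 𝟙 (q ∧ rest)   ≡⟨ cong (𝟙 p *_) (𝟙-∧ q rest) ⟩
      𝟙 p * (𝟙 q * 𝟙 rest) ≡⟨ *-assoc (𝟙 p) (𝟙 q) (𝟙 rest) ⟨
      𝟙 p * 𝟙 q * 𝟙 rest   ≡⟨ cong (𝟙 p * 𝟙 q *_) (allᵇ-subdivisionEdges adj Φ es (f ∘ suc)) ⟩
      _                    ∎
      where
      open ≡-Reasoning
      p = adj (Φ (a ↑ˡ E)) (Φ (V ↑ʳ f zero))
      q = adj (Φ (V ↑ʳ f zero)) (Φ (b ↑ˡ E))
      rest = allᵇ (preserves adj Φ) (subdivisionEdges es (tabulate (f ∘ suc)))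

  -- `subdivision` builds its edge list with a local function that cannot be named.  The first `with`
  -- normalises the goal so that this function appears applied to `allFin (e H)` and `edges H`; once
  -- both are abstracted, the meta `go` is solved by it and its defining clauses hold by refl.
  -- Indexing `Agrees` by `H` rather than by `v H` and `e H` keeps that abstraction well typed.
  record Agrees (H : Graph) (es : List (Fin (v H) × Fin (v H))) (is : List (Fin (e H)))
                (l : List (Fin (v H + e H) × Fin (v H + e H))) : Set where
    field agrees : l ≡ subdivisionEdges es is

  edges-subdivision : ∀ H → edges (subdivision H) ≡ subdivisionEdges (edges H) (allFin (e H))
  edges-subdivision H = Agrees.agrees proof
    where
    go : List (Fin (v H) × Fin (v H)) → List (Fin (e H)) → List (Fin (v H + e H) × Fin (v H + e H))
    go = _
    proof : Agrees H (edges H) (allFin (e H)) (edges (subdivision H))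
    proof with allFin (e H)
    ... | is₀ with is₀ | edges H
    ... | is | es = record
      { agrees = subdivisionEdges-unique go (λ _ _ _ _ _ → refl) (λ _ → refl) (λ _ _ → refl) es is }

  e-subdivision : ∀ H → e (subdivision H) ≡ e H + e H
  e-subdivision H =
    trans (cong length (edges-subdivision H)) (length-subdivisionEdges (edges H) (λ j → j))

  source target : ∀ H → Fin (e H) → Fin (v H)
  source H j = proj₁ (lookup (edges H) j)
  target H j = proj₂ (lookup (edges H) j)

  hom-subdivision : ∀ H n adj → hom (subdivision H) n adj ≡
    ∑[ φ ∈ allMaps (v H) n ] ∏ (λ j → walks₂ adj (φ (source H j)) (φ (target H j)))
  hom-subdivision H n adj = begin
    hom (subdivision H) n adj
      ≡⟨ hom-as-∑ (subdivision H) n adj ⟩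
    ∑[ Φ ∈ allMaps (V + E) n ] 𝟙 (allᵇ (preserves adj Φ) (edges (subdivision H)))
      ≡⟨ ∑-cong (allMaps (V + E) n) (λ Φ → trans (cong (𝟙 ∘ allᵇ (preserves adj Φ)) (edges-subdivision H))
                                                 (allᵇ-subdivisionEdges adj Φ (edges H) (λ j → j))) ⟩
    ∑[ Φ ∈ allMaps (V + E) n ] W (Φ ∘ (_↑ˡ E)) (Φ ∘ (V ↑ʳ_))
      ≡⟨ ∑-allMaps-++ V E _ (λ Φ≗Φ′ → W-cong (Φ≗Φ′ ∘ (_↑ˡ E)) (Φ≗Φ′ ∘ (V ↑ʳ_))) ⟩
    ∑[ φ ∈ allMaps V n ] ∑[ ψ ∈ allMaps E n ] W ((φ ++ ψ) ∘ (_↑ˡ E)) ((φ ++ ψ) ∘ (V ↑ʳ_))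
      ≡⟨ ∑-cong (allMaps V n) (λ φ → ∑-cong (allMaps E n) (λ ψ →
           W-cong (lookup-++ˡ φ ψ) (lookup-++ʳ φ ψ))) ⟩
    ∑[ φ ∈ allMaps V n ] ∑[ ψ ∈ allMaps E n ] W φ ψ
      ≡⟨ ∑-cong (allMaps V n) (λ φ → ∑-allMaps-∏ E (λ j z → walk₂ adj (φ (a j)) z (φ (b j)))) ⟩
    ∑[ φ ∈ allMaps V n ] ∏ (λ j → walks₂ adj (φ (a j)) (φ (b j)))
      ∎
    where
    open ≡-Reasoning
    V = v H
    E = e H
    a b : Fin E → Fin V
    a = source H
    b = target H
    W : Vector (Fin n) V → Vector (Fin n) E → ℕ
    W φ ψ = ∏ (λ j → walk₂ adj (φ (a j)) (ψ j) (φ (b j)))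
    W-cong : ∀ {φ φ′ ψ ψ′} → φ ≗ φ′ → ψ ≗ ψ′ → W φ ψ ≡ W φ′ ψ′
    W-cong φ≗φ′ ψ≗ψ′ = ∏-cong (λ j → walk₂-cong adj (φ≗φ′ (a j)) (ψ≗ψ′ j) (φ≗φ′ (b j)))

module Fractions where
  open import Data.Nat using (_≤_)
  open import Data.Integer using (+_)
  import Data.Integer as ℤ
  import Data.Integer.Properties as ℤ
  import Data.Rational as ℚ
  open import Data.Rational.Properties using (toℚᵘ-cancel-≤; toℚᵘ-fromℚᵘ; toℚᵘ-homo-*)
  import Data.Rational.Unnormalised as ℚᵘ
  import Data.Rational.Unnormalised.Properties as ℚᵘₚ
  open ℚᵘ using (mkℚᵘ; *≤*; _≃_)

  toℚᵘ-/ : ∀ x c .{{_ : NonZero c}} → ℚ.toℚᵘ ((+ x) ℚ./ c) ≃ (+ x) ℚᵘ./ c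
  toℚᵘ-/ x (suc c) = toℚᵘ-fromℚᵘ (mkℚᵘ (+ x) c)

  /ᵘ-*-/ᵘ : ∀ x y c d .{{_ : NonZero c}} .{{_ : NonZero d}} →
            ((+ x) ℚᵘ./ c) ℚᵘ.* ((+ y) ℚᵘ./ d) ≃ ((+ (x * y)) ℚᵘ./ (c * d)) {{m*n≢0 c d}}
  /ᵘ-*-/ᵘ x y (suc c) (suc d) =
    ℚᵘₚ.≃-reflexive (cong (ℚᵘ._/ (suc c * suc d)) (sym (ℤ.pos-* x y)))

  toℚᵘ-/-^ℚ : ∀ x c k .{{_ : NonZero c}} →
              ℚ.toℚᵘ (((+ x) ℚ./ c) ^ℚ k) ≃ ((+ (x ^ k)) ℚᵘ./ (c ^ k)) {{m^n≢0 c k}}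
  toℚᵘ-/-^ℚ x c zero    = ℚᵘₚ.≃-refl
  toℚᵘ-/-^ℚ x c (suc k) = ℚᵘₚ.≃-trans (toℚᵘ-homo-* ((+ x) ℚ./ c) (((+ x) ℚ./ c) ^ℚ k))
    (ℚᵘₚ.≃-trans (ℚᵘₚ.*-cong (toℚᵘ-/ x c) (toℚᵘ-/-^ℚ x c k))
                 (/ᵘ-*-/ᵘ x (x ^ k) c (c ^ k) {{_}} {{m^n≢0 c k}}))

  /ᵘ-≤-/ᵘ : ∀ x y c d .{{_ : NonZero c}} .{{_ : NonZero d}} →
            x * d ≤ y * c → (+ x) ℚᵘ./ c ℚᵘ.≤ (+ y) ℚᵘ./ d
  /ᵘ-≤-/ᵘ x y (suc c) (suc d) xd≤yc =
    *≤* (subst₂ ℤ._≤_ (ℤ.pos-* x (suc d)) (ℤ.pos-* y (suc c)) (ℤ.+≤+ xd≤yc))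

  /-^ℚ-≤-/ : ∀ x y c d k .{{_ : NonZero c}} .{{_ : NonZero d}} →
             x ^ k * d ≤ y * c ^ k → ((+ x) ℚ./ c) ^ℚ k ℚ.≤ (+ y) ℚ./ d
  /-^ℚ-≤-/ x y c d k xᵏd≤ycᵏ = toℚᵘ-cancel-≤
    (ℚᵘₚ.≤-respˡ-≃ (ℚᵘₚ.≃-sym (toℚᵘ-/-^ℚ x c k))
      (ℚᵘₚ.≤-respʳ-≃ (ℚᵘₚ.≃-sym (toℚᵘ-/ y d))
        (/ᵘ-≤-/ᵘ (x ^ k) y (c ^ k) d {{m^n≢0 c k}} xᵏd≤ycᵏ)))

module CayleyCounts {n : ℕ} {op : Fin n → Fin n → Fin n} {ε : Fin n} {inv : Fin n → Fin n}
                    (isAbelianGroup : IsAbelianGroup _≡_ op ε inv)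
                    (S : Fin n → Bool) (S-sym : ∀ x → S (inv x) ≡ S x) where
  open Sums
  open MapSums
  open Homomorphisms
  open Autocorrelation isAbelianGroup
  open import Data.Nat using (_≤_)
  open import Algebra.Properties.CommutativeSemigroup *-commutativeSemigroup using (interchange)
  open import Data.Nat.Solver using (module +-*-Solver)
  open +-*-Solver using (solve; _:=_; _:*_)

  private
    A : Fin n → ℕ
    A = 𝟙 ∘ S

    cay : Fin n → Fin n → Bool
    cay = Cay n op inv S

  hom-K₂-Cay : hom K₂ n cay ≡ n * ∑ (allFin n) A
  hom-K₂-Cay = trans (hom-K₂ n cay) (∑-∑-difference A)

  hom-subdivision-Cay : ∀ H → hom (subdivision H) n cay ≡
    ∑[ φ ∈ allMaps (v H) n ] ∏ (λ j → autocorrelation A (φ (source H j) ∙ φ (target H j) ⁻¹))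
  hom-subdivision-Cay H = trans (hom-subdivision H n cay)
    (∑-cong (allMaps (v H) n) (λ φ →
      ∏-cong {e H} (λ j → convolution≡autocorrelation A (cong 𝟙 ∘ S-sym) _ _)))

  ^-distribʳ-* : ∀ m k j → (m * k) ^ j ≡ m ^ j * k ^ j
  ^-distribʳ-* m k zero    = refl
  ^-distribʳ-* m k (suc j) =
    trans (cong (m * k *_) (^-distribʳ-* m k j)) (interchange m k (m ^ j) (k ^ j))

  cross-multiply : ∀ s D V E → n ^ V * (s ^ E * s ^ E) ≤ n ^ E * D →
                   (n * s) ^ (E + E) * n ^ (V + E) ≤ D * (n ^ 2) ^ (E + E)
  cross-multiply s D V E bound = subst₂ _≤_ (sym lhs) (sym rhs) (*-monoʳ-≤ (P * P * P) bound)
    where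
    P = n ^ E
    Q = s ^ E
    R = n ^ V
    nsᴱ : (n * s) ^ E ≡ P * Q
    nsᴱ = ^-distribʳ-* n s E
    lhs : (n * s) ^ (E + E) * n ^ (V + E) ≡ P * P * P * (R * (Q * Q))
    lhs = trans (cong₂ _*_ (trans (^-distribˡ-+-* (n * s) E E) (cong₂ _*_ nsᴱ nsᴱ)) (^-distribˡ-+-* n V E))
                (solve 3 (λ P Q R → ((P :* Q) :* (P :* Q)) :* (R :* P) := P :* P :* P :* (R :* (Q :* Q)))
                       refl P Q R)
    n²ᴱ : (n ^ 2) ^ E ≡ P * P
    n²ᴱ = trans (cong (λ m → (n * m) ^ E) (*-identityʳ n)) (^-distribʳ-* n n E)
    rhs : D * (n ^ 2) ^ (E + E) ≡ P * P * P * (P * D)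
    rhs = trans (cong (D *_) (trans (^-distribˡ-+-* (n ^ 2) E E) (cong₂ _*_ n²ᴱ n²ᴱ)))
                (solve 2 (λ P D → D :* ((P :* P) :* (P :* P)) := P :* P :* P :* (P :* D)) refl P D)

  subdivision-count-≥ : ∀ H →
    hom K₂ n cay ^ e (subdivision H) * n ^ (v H + e H) ≤
    hom (subdivision H) n cay * (n ^ 2) ^ e (subdivision H)
  subdivision-count-≥ H rewrite hom-K₂-Cay | hom-subdivision-Cay H | e-subdivision H =
    cross-multiply _ _ (v H) (e H) (∑∏-autocorrelation-≥ A (source H) (target H))

open import Data.Rational using (_≤_)
open Fractions
open CayleyCounts

proposition4 : (n : ℕ) .{{_ : NonZero n}}
    (_+G_ : Fin n → Fin n → Fin n) (0G : Fin n) (-G_ : Fin n → Fin n) →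
    IsAbelianGroup _≡_ _+G_ 0G -G_ →
    (S : Fin n → Bool) → S 0G ≡ false → (∀ x → S (-G x) ≡ S x) →
    (H₁ : Graph) → IsSimple H₁ →
    (t K₂ n (Cay n _+G_ -G_ S) ^ℚ e (subdivision H₁)) ≤ t (subdivision H₁) n (Cay n _+G_ -G_ S)
proposition4 n _+G_ 0G -G_ isAbelianGroup S _ S-sym H₁ _ =
  /-^ℚ-≤-/ (hom K₂ n cay) (hom (subdivision H₁) n cay) (n ^ 2) (n ^ (v H₁ + e H₁)) (e (subdivision H₁))
    {{m^n≢0 n 2}} {{m^n≢0 n (v H₁ + e H₁)}} (subdivision-count-≥ isAbelianGroup S S-sym H₁)
  where
  cay = Cay n _+G_ -G_ S
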